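{- Let $G$ be a triangle-free graph of order $n\geq 4$. Then $PRC(G)=n$ if and only if $G\in\mathcal{T}_1\cup\mathcal{T}_2$, where $\mathcal{T}_1$ is the family of graphs $K_{r,r}-M$ with $r\geq 2$ and $M$ a perfect matching of $K_{r,r}$, and $\mathcal{T}_2$ is the family of graphs $K_{r,s}-M$ with $r,s\geq 2$ and $M$ a (possibly empty) matching of $K_{r,s}$ with $|M|<\min\{r,s\}$.
   Context: All graphs are simple, finite and undirected; $K_{r,s}$ is the complete bipartite graph with parts of sizes $r,s$, and $H-M$ denotes deleting the edge set $M$ from $H$. A set $S\subseteq V(G)$ is a dominating set if every vertex not in $S$ has a neighbor in $S$; $S$ is a perfect dominating set if every vertex in $V(G)\setminus S$ has exactly one neighbor in $S$. A perfect coalition in $G$ consists of two disjoint sets $V_1,V_2$ of vertices such that (i) neither $V_1$ nor $V_2$ is a dominating set of $G$; (ii) each vertex in $V(G)\setminus V_1$ has at most one neighbor in $V_1$, and each vertex in $V(G)\setminus V_2$ has at most one neighbor in $V_2$; (iii) $V_1\cup V_2$ is a perfect dominating set of $G$. A perfect coalition partition ($prc$-partition) of $G$ is a vertex partition $\pi=\{V_1,\dots,V_k\}$ such that each $V_i$ either is a singleton dominating set or forms a perfect coalition with some $V_j\in\pi$. $PRC(G)$ is the maximum cardinality of a $prc$-partition of $G$, with $PRC(G)=0$ if $G$ has no $prc$-partition. -}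

module Defs where

open import Data.Nat using (ℕ; _≤_; _<_; _⊓_)
open import Data.Fin using (Fin)
open import Data.Sum using (_⊎_; inj₁; inj₂)
open import Data.Product using (Σ; ∃; ∃-syntax; _×_; _,_)
open import Data.Empty using (⊥)
open import Relation.Nullary using (¬_; Dec)
open import Relation.Binary.PropositionalEquality using (_≡_)
open import Function.Bundles using (_⤖_; Bijection; _⇔_)
open import Function.Definitions using (Injective)

record Graph (n : ℕ) : Set₁ where
  field
    Adj    : Fin n → Fin n → Set
    sym    : ∀ {u v} → Adj u v → Adj v u
    irrefl : ∀ {u} → ¬ Adj u u
    adj?   : ∀ u v → Dec (Adj u v)
open Graph public

TriangleFree : ∀ {n} → Graph n → Set
TriangleFree G = ∀ u v w → Adj G u v → Adj G v w → Adj G u w → ⊥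

module _ {n : ℕ} (G : Graph n) where

  Dominating : (Fin n → Set) → Set
  Dominating S = ∀ v → ¬ S v → ∃[ u ] (S u × Adj G v u)

  ExactlyOneNbr : (Fin n → Set) → Fin n → Set
  ExactlyOneNbr S v =
    ∃[ u ] (S u × Adj G v u × (∀ w → S w → Adj G v w → w ≡ u))

  AtMostOneNbr : (Fin n → Set) → Fin n → Set
  AtMostOneNbr S v =
    ∀ u w → S u → Adj G v u → S w → Adj G v w → u ≡ w

  PerfectDominating : (Fin n → Set) → Set
  PerfectDominating S = ∀ v → ¬ S v → ExactlyOneNbr S v

  PerfectCoalition : (Fin n → Set) → (Fin n → Set) → Set
  PerfectCoalition V₁ V₂ =
    (∀ v → V₁ v → V₂ v → ⊥)
    × ¬ Dominating V₁ × ¬ Dominating V₂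
    × (∀ v → ¬ V₁ v → AtMostOneNbr V₁ v)
    × (∀ v → ¬ V₂ v → AtMostOneNbr V₂ v)
    × PerfectDominating (λ v → V₁ v ⊎ V₂ v)

  -- A vertex partition into k (nonempty) classes, given as a surjective
  -- labelling f : Fin n → Fin k; class i is { v | f v ≡ i }.

  Class : ∀ {k} → (Fin n → Fin k) → Fin k → Fin n → Set
  Class f i v = f v ≡ i

  IsSingleton : (Fin n → Set) → Set
  IsSingleton S = ∃[ v ] (∀ w → (S w → w ≡ v) × (w ≡ v → S w))

  IsPRCPartition : ∀ {k} → (Fin n → Fin k) → Set
  IsPRCPartition {k} f =
    (∀ i → ∃[ v ] (f v ≡ i))
    × (∀ i → (IsSingleton (Class f i) × Dominating (Class f i))
             ⊎ ∃[ j ] ((¬ i ≡ j) × PerfectCoalition (Class f i) (Class f j)))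

  HasPRCPartition : ℕ → Set
  HasPRCPartition k = Σ (Fin n → Fin k) IsPRCPartition

  -- PRC(G) ≡ k : the maximum cardinality of a prc-partition is k,
  -- or k = 0 and G has no prc-partition.
  PRCis : ℕ → Set
  PRCis k =
    (HasPRCPartition k × (∀ m → HasPRCPartition m → m ≤ k))
    ⊎ (k ≡ 0 × (∀ m → ¬ HasPRCPartition m))

-- Matchings of K_{r,s} with m edges: edge t joins a t (left) to b t
-- (right); injectivity of a and b means edges are pairwise disjoint.

record Matching (r s m : ℕ) : Set where
  field
    left   : Fin m → Fin r
    right  : Fin m → Fin s
    left-inj  : Injective _≡_ _≡_ left
    right-inj : Injective _≡_ _≡_ right
open Matching public

InMatching : ∀ {r s m} → Matching r s m → Fin r → Fin s → Set
InMatching M x y = ∃[ t ] (left M t ≡ x × right M t ≡ y)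

KminusAdj : ∀ {r s m} → Matching r s m → (Fin r ⊎ Fin s) → (Fin r ⊎ Fin s) → Set
KminusAdj M (inj₁ x) (inj₁ y) = ⊥
KminusAdj M (inj₁ x) (inj₂ y) = ¬ InMatching M x y
KminusAdj M (inj₂ x) (inj₁ y) = ¬ InMatching M y x
KminusAdj M (inj₂ x) (inj₂ y) = ⊥

IsoKminus : ∀ {n r s m} → Graph n → Matching r s m → Set
IsoKminus {n} {r} {s} G M =
  Σ (Fin n ⤖ (Fin r ⊎ Fin s)) λ σ →
    ∀ u v → Adj G u v ⇔ KminusAdj M (Bijection.to σ u) (Bijection.to σ v)

InT1 : ∀ {n} → Graph n → Set
InT1 G = ∃[ r ] (2 ≤ r × Σ (Matching r r r) λ M → IsoKminus G M)

InT2 : ∀ {n} → Graph n → Set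
InT2 G = ∃[ r ] ∃[ s ] ∃[ m ]
  (2 ≤ r × 2 ≤ s × m < r ⊓ s × Σ (Matching r s m) λ M → IsoKminus G M)

{-# OPTIONS --safe #-}
-- With n classes every class of a prc-partition is a singleton, so PRC(G) = n says that every
-- vertex u has a perfect partner v: neither is universal and every other vertex is adjacent to
-- exactly one of them.  A universal vertex is impossible in a triangle-free graph on n ≥ 4
-- vertices.  In a triangle-free graph a perfect pair u, v splits the vertices into the
-- independent sets {u} ∪ N(v) and {v} ∪ N(u).  In this bipartite graph partners force every
-- vertex to miss at most one vertex of the other side, so the non-edges across form a matching M
-- and G ≅ K_{r,s} − M.  The partner of an unmatched vertex is an unmatched vertex of the other
-- side, so M is perfect or leaves vertices unmatched on both sides; n ≥ 4 gives r, s ≥ 2.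
-- Conversely, in K_{r,s} − M a matched vertex is partnered with its mate and an unmatched vertex
-- with any unmatched vertex of the other side.
module Submission where

open import Defs hiding (sym)
open import Data.Bool using (Bool; true; false)
open import Data.Bool.Properties using (¬-not) renaming (_≟_ to _≟ᵇ_)
open import Data.Empty using (⊥; ⊥-elim)
open import Data.Fin using (Fin; zero; suc; fromℕ<)
open import Data.Fin.Properties
  using (_≟_; any?; all?; ¬∀⟶∃¬; injective⇒≤; punchOut-injective; cantor-schröder-bernstein)
open import Data.List using (List; []; _∷_; length; lookup)
open import Data.List.Relation.Unary.All using (All; []; _∷_)
open import Data.List.Relation.Unary.All.Properties using (¬Any⇒All¬)
open import Data.List.Relation.Unary.Any using (Any; index)
import Data.List.Relation.Unary.Any as Any
open import Data.List.Relation.Unary.Any.Properties using (lookup-index)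
open import Data.Nat using (ℕ; zero; suc; _≤_; _<_; z≤n; s≤s; _≤?_)
open import Data.Nat.Properties using (≤-trans; <⇒≱; <-irrefl; n≤1+n; ⊓-glb; m⊓n≤m; m⊓n≤n)
open import Data.Product using (Σ; ∃; _×_; _,_; proj₁; proj₂)
open import Data.Sum using (_⊎_; inj₁; inj₂)
import Data.Sum as Sum
open import Data.Sum.Properties using (inj₁-injective; inj₂-injective; swap-involutive)
open import Function using (_∘_; id)
open import Function.Bundles using (_⇔_; mk⇔; _⤖_; Bijection; Equivalence; mk↔ₛ′)
open import Function.Definitions using (Injective; StrictlySurjective)
open import Function.Properties.Inverse using (↔⇒⤖)
open import Relation.Nullary using (¬_; Dec; yes; no; does; ¬?; contradiction)
open import Relation.Nullary.Decidable using (decidable-stable; _⊎-dec_)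
open import Relation.Unary using (Decidable)
open import Relation.Binary.PropositionalEquality
  using (_≡_; _≢_; refl; sym; trans; cong; subst; subst₂; module ≡-Reasoning)

section-injective : ∀ {A B : Set} {f : A → B} (surjective : StrictlySurjective _≡_ f) →
                    Injective _≡_ _≡_ (proj₁ ∘ surjective)
section-injective {f = f} surjective {x} {y} e =
  trans (sym (proj₂ (surjective x))) (trans (cong f e) (proj₂ (surjective y)))

injective-missing⇒< : ∀ {m k} {f : Fin m → Fin k} → Injective _≡_ _≡_ f →
                      (j : Fin k) → (∀ i → f i ≢ j) → m < k
injective-missing⇒< {k = suc _} f-injective j missed =
  s≤s (injective⇒≤ (f-injective ∘ punchOut-injective (missed _ ∘ sym) (missed _ ∘ sym)))

<⇒missing : ∀ {m k} (f : Fin m → Fin k) → m < k → ∃ λ j → ∀ i → f i ≢ j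
<⇒missing f m<k with ¬∀⟶∃¬ _ _ (λ j → any? (λ i → f i ≟ j))
                          (λ surjective → <⇒≱ m<k (injective⇒≤ (section-injective surjective)))
... | j , unhit = j , λ i fi≡j → unhit (i , fi≡j)

injective∧surjective⇒≡ : ∀ {m k} {f : Fin m → Fin k} →
                         Injective _≡_ _≡_ f → StrictlySurjective _≡_ f → m ≡ k
injective∧surjective⇒≡ f-injective surjective =
  cantor-schröder-bernstein f-injective (section-injective surjective)

injective⇒surjective : ∀ {n} {f : Fin n → Fin n} → Injective _≡_ _≡_ f → StrictlySurjective _≡_ f
injective⇒surjective {f = f} f-injective j with any? (λ i → f i ≟ j)
... | yes hit = hit
... | no unhit = contradiction (injective-missing⇒< f-injective j λ i e → unhit (i , e)) (<-irrefl refl)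

surjective⇒injective : ∀ {n} {f : Fin n → Fin n} → StrictlySurjective _≡_ f → Injective _≡_ _≡_ f
surjective⇒injective {f = f} surjective {x} {y} fx≡fy = begin
  x        ≡⟨ retraction x ⟨
  g (f x)  ≡⟨ cong g fx≡fy ⟩
  g (f y)  ≡⟨ retraction y ⟩
  y        ∎
  where
  open ≡-Reasoning
  g : Fin _ → Fin _
  g = proj₁ ∘ surjective
  retraction : ∀ x → g (f x) ≡ x
  retraction x with injective⇒surjective (section-injective surjective) x
  ... | i , refl = cong g (proj₂ (surjective i))

fresh : ∀ {n} (xs : List (Fin n)) → length xs < n → ∃ λ x → All (x ≢_) xs
fresh {n} xs |xs|<n with any? (λ x → ¬? (Any.any? (x ≟_) xs))
... | yes (x , x∉xs) = x , ¬Any⇒All¬ xs x∉xs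
... | no ¬fresh = contradiction (injective⇒≤ position-injective) (<⇒≱ |xs|<n)
  where
  member : ∀ x → Any (x ≡_) xs
  member x = decidable-stable (Any.any? (x ≟_) xs) (λ x∉xs → ¬fresh (x , x∉xs))
  position : Fin n → Fin (length xs)
  position = index ∘ member
  position-injective : Injective _≡_ _≡_ position
  position-injective {x} {y} e =
    trans (lookup-index (member x)) (trans (cong (lookup xs) e) (sym (lookup-index (member y))))

¬2≤⇒≡ : ∀ {r} → ¬ 2 ≤ r → (i j : Fin r) → i ≡ j
¬2≤⇒≡ {suc zero} _ zero zero = refl
¬2≤⇒≡ {suc (suc r)} ¬2≤r _ _ = contradiction (s≤s (s≤s z≤n)) ¬2≤r

another : ∀ {r} → 2 ≤ r → (i : Fin r) → ∃ λ j → j ≢ i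
another (s≤s (s≤s _)) zero = suc zero , λ ()
another (s≤s (s≤s _)) (suc i) = zero , λ ()

-- Q is kept apart from ¬ P so that Split-swap needs no double negation.
record Split {n : ℕ} (P Q : Fin n → Set) : Set where
  field
    #P #Q     : ℕ
    to        : Fin n → Fin #P ⊎ Fin #Q
    from      : Fin #P ⊎ Fin #Q → Fin n
    from-to   : ∀ v → from (to v) ≡ v
    to-from   : ∀ w → to (from w) ≡ w
    from-inj₁ : ∀ i → P (from (inj₁ i))
    from-inj₂ : ∀ j → Q (from (inj₂ j))

  bijection : Fin n ⤖ (Fin #P ⊎ Fin #Q)
  bijection = ↔⇒⤖ (mk↔ₛ′ to from to-from from-to)

  from-injective : Injective _≡_ _≡_ from
  from-injective {w} {w′} e = trans (sym (to-from w)) (trans (cong to e) (to-from w′))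

  preimage : ∀ v → (∃ λ i → from (inj₁ i) ≡ v) ⊎ (∃ λ j → from (inj₂ j) ≡ v)
  preimage v with to v | from-to v
  ... | inj₁ i | e = inj₁ (i , e)
  ... | inj₂ j | e = inj₂ (j , e)

Split-swap : ∀ {n} {P Q : Fin n → Set} → Split P Q → Split Q P
Split-swap S = record
  { #P = #Q ; #Q = #P ; to = Sum.swap ∘ to ; from = from ∘ Sum.swap
  ; from-to = λ v → trans (cong from (swap-involutive (to v))) (from-to v)
  ; to-from = λ w → trans (cong Sum.swap (to-from (Sum.swap w))) (swap-involutive w)
  ; from-inj₁ = from-inj₂ ; from-inj₂ = from-inj₁ }
  where open Split S

Split-cons : ∀ {n} {P Q : Fin (suc n) → Set} → P zero → Split (P ∘ suc) (Q ∘ suc) → Split P Q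
Split-cons {n} {P} {Q} p0 S = record
  { #P = suc S.#P ; #Q = S.#Q ; to = to ; from = from
  ; from-to = from-to ; to-from = to-from ; from-inj₁ = from-inj₁ ; from-inj₂ = S.from-inj₂ }
  where
  module S = Split S
  to : Fin (suc n) → Fin (suc S.#P) ⊎ Fin S.#Q
  to zero = inj₁ zero
  to (suc v) = Sum.map₁ suc (S.to v)
  from : Fin (suc S.#P) ⊎ Fin S.#Q → Fin (suc n)
  from (inj₁ zero) = zero
  from (inj₁ (suc i)) = suc (S.from (inj₁ i))
  from (inj₂ j) = suc (S.from (inj₂ j))
  from-to : ∀ v → from (to v) ≡ v
  from-to zero = refl
  from-to (suc v) with S.to v | S.from-to v
  ... | inj₁ i | e = cong suc e
  ... | inj₂ j | e = cong suc e
  to-from : ∀ w → to (from w) ≡ w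
  to-from (inj₁ zero) = refl
  to-from (inj₁ (suc i)) = cong (Sum.map₁ suc) (S.to-from (inj₁ i))
  to-from (inj₂ j) = cong (Sum.map₁ suc) (S.to-from (inj₂ j))
  from-inj₁ : ∀ i → P (from (inj₁ i))
  from-inj₁ zero = p0
  from-inj₁ (suc i) = S.from-inj₁ i

split : ∀ {n} {P : Fin n → Set} → Decidable P → Split P (¬_ ∘ P)
split {zero} _ = record
  { #P = 0 ; #Q = 0 ; to = λ () ; from = λ { (inj₁ ()) ; (inj₂ ()) }
  ; from-to = λ () ; to-from = λ { (inj₁ ()) ; (inj₂ ()) } ; from-inj₁ = λ () ; from-inj₂ = λ () }
split {suc n} P? with P? zero
... | yes p0 = Split-cons p0 (split (P? ∘ suc))
... | no ¬p0 = Split-swap (Split-cons ¬p0 (Split-swap (split (P? ∘ suc))))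

module _ {n} {P : Fin n → Set} (S : Split P (¬_ ∘ P)) where
  open Split S

  inj₁-preimage : ∀ {v} → P v → ∃ λ i → from (inj₁ i) ≡ v
  inj₁-preimage {v} pv with preimage v
  ... | inj₁ hit = hit
  ... | inj₂ (j , refl) = contradiction pv (from-inj₂ j)

  inj₂-preimage : ∀ {v} → ¬ P v → ∃ λ j → from (inj₂ j) ≡ v
  inj₂-preimage {v} ¬pv with preimage v
  ... | inj₁ (i , refl) = contradiction (from-inj₁ i) ¬pv
  ... | inj₂ hit = hit

-- Perfect pairs

module _ {A : Set} (_~_ : A → A → Set) where

  Universal : A → Set
  Universal u = ∀ w → w ≢ u → w ~ u

  record PerfectPair (u v : A) : Set where
    field
      distinct    : u ≢ v
      ¬universalˡ : ¬ Universal u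
      ¬universalʳ : ¬ Universal v
      cover       : ∀ w → w ≢ u → w ≢ v → w ~ u ⊎ w ~ v
      exclusive   : ∀ w → w ≢ u → w ≢ v → w ~ u → w ~ v → ⊥

  Partnered : Set
  Partnered = ∀ u → ∃ (PerfectPair u)

module _ {A : Set} {_~_ : A → A → Set} where

  PerfectPair-sym : ∀ {u v} → PerfectPair _~_ u v → PerfectPair _~_ v u
  PerfectPair-sym pair = record
    { distinct = distinct ∘ sym ; ¬universalˡ = ¬universalʳ ; ¬universalʳ = ¬universalˡ
    ; cover = λ w w≢v w≢u → Sum.swap (cover w w≢u w≢v)
    ; exclusive = λ w w≢v w≢u w~v w~u → exclusive w w≢u w≢v w~u w~v }
    where open PerfectPair pair

module _ {A B : Set} {_≈_ : A → A → Set} {_~_ : B → B → Set} (σ : A ⤖ B)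
         (preserves : ∀ u v → u ≈ v ⇔ Bijection.to σ u ~ Bijection.to σ v) where
  open Bijection σ using (to; injective; strictlySurjective)

  Universal-transport : ∀ {u} → Universal _≈_ u → Universal _~_ (to u)
  Universal-transport {u} univ b b≢u with strictlySurjective b
  ... | w , refl = Equivalence.to (preserves w u) (univ w (b≢u ∘ cong to))

  PerfectPair-reflect : ∀ {u v} → PerfectPair _~_ (to u) (to v) → PerfectPair _≈_ u v
  PerfectPair-reflect {u} {v} pair = record
    { distinct = distinct ∘ cong to
    ; ¬universalˡ = ¬universalˡ ∘ Universal-transport
    ; ¬universalʳ = ¬universalʳ ∘ Universal-transport
    ; cover = λ w w≢u w≢v → Sum.map (Equivalence.from (preserves w u)) (Equivalence.from (preserves w v))
                               (cover (to w) (w≢u ∘ injective) (w≢v ∘ injective))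
    ; exclusive = λ w w≢u w≢v w≈u w≈v → exclusive (to w) (w≢u ∘ injective) (w≢v ∘ injective)
                    (Equivalence.to (preserves w u) w≈u) (Equivalence.to (preserves w v) w≈v) }
    where open PerfectPair pair

  Partnered-reflect : Partnered _~_ → Partnered _≈_
  Partnered-reflect partnered u with partnered (to u)
  ... | b , pair with strictlySurjective b
  ...   | v , refl = v , PerfectPair-reflect pair

module _ {n : ℕ} (G : Graph n) where
  private
    _~_ : Fin n → Fin n → Set
    _~_ = Adj G

  coalition⇒PerfectPair : ∀ {V₁ V₂ : Fin n → Set} {u v} →
    (∀ {w} → V₁ w → w ≡ u) → (∀ {w} → V₂ w → w ≡ v) → V₁ u → V₂ v →
    PerfectCoalition G V₁ V₂ → PerfectPair _~_ u v
  coalition⇒PerfectPair {V₁} {V₂} {u} {v} only₁ only₂ u∈V₁ v∈V₂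
                        (disjoint , ¬dom₁ , ¬dom₂ , _ , _ , perfect) = record
    { distinct = λ u≡v → disjoint u u∈V₁ (subst V₂ (sym u≡v) v∈V₂)
    ; ¬universalˡ = ¬dom₁ ∘ dominating only₁ u∈V₁
    ; ¬universalʳ = ¬dom₂ ∘ dominating only₂ v∈V₂
    ; cover = cover
    ; exclusive = exclusive }
    where
    dominating : ∀ {V x} → (∀ {w} → V w → w ≡ x) → V x → Universal _~_ x → Dominating G V
    dominating only x∈V univ w w∉V = _ , x∈V , univ w λ { refl → w∉V x∈V }
    outside : ∀ {w} → w ≢ u → w ≢ v → ¬ (V₁ w ⊎ V₂ w)
    outside w≢u w≢v = Sum.[ w≢u ∘ only₁ , w≢v ∘ only₂ ]
    cover : ∀ w → w ≢ u → w ≢ v → w ~ u ⊎ w ~ v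
    cover w w≢u w≢v with perfect w (outside w≢u w≢v)
    ... | z , inj₁ z∈V₁ , w~z , _ = inj₁ (subst (w ~_) (only₁ z∈V₁) w~z)
    ... | z , inj₂ z∈V₂ , w~z , _ = inj₂ (subst (w ~_) (only₂ z∈V₂) w~z)
    exclusive : ∀ w → w ≢ u → w ≢ v → w ~ u → w ~ v → ⊥
    exclusive w w≢u w≢v w~u w~v with perfect w (outside w≢u w≢v)
    ... | _ , _ , _ , unique =
      disjoint u u∈V₁ (subst V₂ (trans (unique v (inj₂ v∈V₂) w~v) (sym (unique u (inj₁ u∈V₁) w~u))) v∈V₂)

  PerfectPair⇒coalition : ∀ {u v} → PerfectPair _~_ u v → PerfectCoalition G (_≡ u) (_≡ v)
  PerfectPair⇒coalition {u} {v} pair =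
    (λ _ w≡u w≡v → distinct (trans (sym w≡u) w≡v)) ,
    ¬dominating ¬universalˡ , ¬dominating ¬universalʳ ,
    (λ _ _ _ _ a≡u _ b≡u _ → trans a≡u (sym b≡u)) ,
    (λ _ _ _ _ a≡v _ b≡v _ → trans a≡v (sym b≡v)) ,
    perfect
    where
    open PerfectPair pair
    ¬dominating : ∀ {x} → ¬ Universal _~_ x → ¬ Dominating G (_≡ x)
    ¬dominating ¬univ dom = ¬univ λ w w≢x → let (_ , z≡x , w~z) = dom w w≢x in subst (w ~_) z≡x w~z
    exclusive′ : ∀ {w} → ¬ (w ≡ u ⊎ w ≡ v) → w ~ u → w ~ v → ⊥
    exclusive′ {w} w∉ = exclusive w (w∉ ∘ inj₁) (w∉ ∘ inj₂)
    perfect : PerfectDominating G (λ w → w ≡ u ⊎ w ≡ v)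
    perfect w w∉ with cover w (w∉ ∘ inj₁) (w∉ ∘ inj₂)
    ... | inj₁ w~u = u , inj₁ refl , w~u , λ { _ (inj₁ z≡u) _ → z≡u
                                               ; _ (inj₂ refl) w~v → ⊥-elim (exclusive′ w∉ w~u w~v) }
    ... | inj₂ w~v = v , inj₂ refl , w~v , λ { _ (inj₂ z≡v) _ → z≡v
                                               ; _ (inj₁ refl) w~u → ⊥-elim (exclusive′ w∉ w~u w~v) }

  prcPartition-size≤ : ∀ {k} → HasPRCPartition G k → k ≤ n
  prcPartition-size≤ (_ , surjective , _) = injective⇒≤ (section-injective surjective)

  Partnered⇒PRC-n : Partnered _~_ → PRCis G n
  Partnered⇒PRC-n partnered = inj₁ (identity-partition , λ _ → prcPartition-size≤)
    where
    identity-partition : HasPRCPartition G n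
    identity-partition = id , (λ i → i , refl) , λ u →
      let (v , pair) = partnered u in inj₂ (v , PerfectPair.distinct pair , PerfectPair⇒coalition pair)

  prcPartition-n⇒universal⊎partner : (f : Fin n → Fin n) → IsPRCPartition G f →
                                     ∀ u → Universal _~_ u ⊎ ∃ (PerfectPair _~_ u)
  prcPartition-n⇒universal⊎partner f (surjective , classes) u
    with surjective⇒injective surjective | classes (f u)
  ... | f-injective | inj₁ (_ , dominating) = inj₁ λ w w≢u →
          let (_ , fz≡fu , w~z) = dominating w (w≢u ∘ f-injective) in subst (w ~_) (f-injective fz≡fu) w~z
  ... | f-injective | inj₂ (j , _ , coalition) =
          let (v , fv≡j) = surjective j
          in inj₂ (v , coalition⇒PerfectPair f-injective (λ fw≡j → f-injective (trans fw≡j (sym fv≡j)))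
                                             refl fv≡j coalition)

  module _ (triangleFree : TriangleFree G) (4≤n : 4 ≤ n) where

    universal⊎partner⇒Partnered : (∀ u → Universal _~_ u ⊎ ∃ (PerfectPair _~_ u)) → Partnered _~_
    universal⊎partner⇒Partnered alternatives u with alternatives u
    ... | inj₂ partner = partner
    ... | inj₁ univ with fresh (u ∷ []) (≤-trans (s≤s (s≤s z≤n)) 4≤n)
    ...   | w , w≢u ∷ [] with alternatives w
    ...     | inj₁ univ-w with fresh (u ∷ w ∷ []) (≤-trans (n≤1+n 3) 4≤n)
    ...       | x , x≢u ∷ x≢w ∷ [] =
      ⊥-elim (triangleFree x u w (univ x x≢u) (Graph.sym G (univ w w≢u)) (univ-w x x≢w))
    universal⊎partner⇒Partnered alternatives u | inj₁ univ | w , w≢u ∷ [] | inj₂ (z , pair)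
      with fresh (u ∷ w ∷ z ∷ []) 4≤n
    ... | x , x≢u ∷ x≢w ∷ x≢z ∷ [] with PerfectPair.cover pair x x≢w x≢z
    ...   | inj₁ x~w = ⊥-elim (triangleFree x w u x~w (univ w w≢u) (univ x x≢u))
    ...   | inj₂ x~z = ⊥-elim (triangleFree x z u x~z (univ z z≢u) (univ x x≢u))
      where
      z≢u : z ≢ u
      z≢u refl = PerfectPair.¬universalʳ pair univ

    PRC-n⇒Partnered : PRCis G n → Partnered _~_
    PRC-n⇒Partnered (inj₁ ((f , isPRC) , _)) =
      universal⊎partner⇒Partnered (prcPartition-n⇒universal⊎partner f isPRC)
    PRC-n⇒Partnered (inj₂ (n≡0 , _)) = contradiction (subst (4 ≤_) n≡0 4≤n) λ ()

  Independent : (Fin n → Set) → Set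
  Independent S = ∀ {a b} → S a → S b → ¬ a ~ b

  PerfectPair⇒independent : TriangleFree G → ∀ {u v} → PerfectPair _~_ u v →
                            Independent (λ w → w ≡ u ⊎ w ~ v)
  PerfectPair⇒independent _ pair (inj₁ refl) (inj₁ refl) a~a = irrefl G a~a
  PerfectPair⇒independent _ pair (inj₁ refl) (inj₂ b~v) u~b =
    PerfectPair.exclusive pair _ (λ { refl → irrefl G u~b }) (λ { refl → irrefl G b~v }) (Graph.sym G u~b) b~v
  PerfectPair⇒independent triangleFree pair (inj₂ a~v) (inj₁ refl) a~u =
    PerfectPair⇒independent triangleFree pair (inj₁ refl) (inj₂ a~v) (Graph.sym G a~u)
  PerfectPair⇒independent triangleFree pair (inj₂ a~v) (inj₂ b~v) a~b = triangleFree _ _ _ a~b b~v a~v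

  Bipartition : (Fin n → Bool) → Set
  Bipartition side = ∀ {a b} → side a ≡ side b → ¬ a ~ b

  independent⇒bipartition : ∀ {X : Fin n → Set} (X? : Decidable X) →
                            Independent X → Independent (¬_ ∘ X) → Bipartition (does ∘ X?)
  independent⇒bipartition X? independent independent-∁ {a} {b} with X? a | X? b
  ... | yes a∈X | yes b∈X = λ _ → independent a∈X b∈X
  ... | no a∉X | no b∉X = λ _ → independent-∁ a∉X b∉X
  ... | yes _ | no _ = λ ()
  ... | no _ | yes _ = λ ()

  PerfectPair⇒bipartition : TriangleFree G → ∀ {u v} → PerfectPair _~_ u v → Σ (Fin n → Bool) Bipartition
  PerfectPair⇒bipartition triangleFree {u} {v} pair =
    does ∘ X? , independent⇒bipartition X? (PerfectPair⇒independent triangleFree pair) independent-∁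
    where
    X : Fin n → Set
    X w = w ≡ u ⊎ w ~ v
    X? : Decidable X
    X? w = (w ≟ u) ⊎-dec (adj? G w v)
    outside-X : ∀ {w} → ¬ X w → w ≡ v ⊎ w ~ u
    outside-X {w} w∉X with w ≟ v
    ... | yes w≡v = inj₁ w≡v
    ... | no w≢v = inj₂ (Sum.[ id , (λ w~v → ⊥-elim (w∉X (inj₂ w~v))) ]
                               (PerfectPair.cover pair w (w∉X ∘ inj₁) w≢v))
    independent-∁ : Independent (¬_ ∘ X)
    independent-∁ a∉X b∉X =
      PerfectPair⇒independent triangleFree (PerfectPair-sym pair) (outside-X a∉X) (outside-X b∉X)

-- Bipartite graphs with perfect partners

opposite⇒≡ : ∀ {x y z : Bool} → x ≢ z → y ≢ z → x ≡ y
opposite⇒≡ x≢z y≢z = trans (¬-not x≢z) (sym (¬-not y≢z))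

module BipartiteGraph {n : ℕ} (G : Graph n) {side : Fin n → Bool} (bipartition : Bipartition G side) where
  private
    _~_ : Fin n → Fin n → Set
    _~_ = Adj G

  PerfectPair-sameSide : ∀ {y d z} → PerfectPair _~_ y d → side d ≡ side y → side z ≡ side y →
                         z ≡ y ⊎ z ≡ d
  PerfectPair-sameSide {y} {d} {z} pair sd sz with z ≟ y | z ≟ d
  ... | yes z≡y | _ = inj₁ z≡y
  ... | no _ | yes z≡d = inj₂ z≡d
  ... | no z≢y | no z≢d =
    ⊥-elim (Sum.[ bipartition sz , bipartition (trans sz (sym sd)) ] (PerfectPair.cover pair z z≢y z≢d))

  PerfectPair-oppositeSide : ∀ {y d z} → PerfectPair _~_ y d → side d ≢ side y → side z ≡ side y →
                             z ≢ y → z ~ d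
  PerfectPair-oppositeSide {y} {d} {z} pair sd sz z≢y =
    Sum.[ (λ z~y → ⊥-elim (bipartition sz z~y)) , id ]
      (PerfectPair.cover pair z z≢y (λ z≡d → sd (trans (cong side (sym z≡d)) sz)))

  PerfectPair-crowded⇒opposite : ∀ {y d z w} → PerfectPair _~_ y d → side z ≡ side y → side w ≡ side y →
                                 z ≢ y → w ≢ y → w ≢ z → side d ≢ side y
  PerfectPair-crowded⇒opposite pair sz sw z≢y w≢y w≢z sd
    with PerfectPair-sameSide pair sd sz | PerfectPair-sameSide pair sd sw
  ... | inj₁ z≡y | _ = z≢y z≡y
  ... | _ | inj₁ w≡y = w≢y w≡y
  ... | inj₂ z≡d | inj₂ w≡d = w≢z (trans w≡d (sym z≡d))

  Complete : Fin n → Set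
  Complete u = ∀ a → side a ≢ side u → a ~ u

  module WithPartners (4≤n : 4 ≤ n) (partnered : Partnered _~_) where

    partner : Fin n → Fin n
    partner = proj₁ ∘ partnered

    pair : ∀ u → PerfectPair _~_ u (partner u)
    pair = proj₂ ∘ partnered

    -- Let d be the partner of y.  If d is on y's side then y′ = d and b sees neither y nor d;
    -- otherwise b = d, which is adjacent to y′.
    nonNeighbour-unique : ∀ {b y y′} → side y ≢ side b → side y′ ≢ side b →
                          ¬ b ~ y → ¬ b ~ y′ → y ≡ y′
    nonNeighbour-unique {b} {y} {y′} sy sy′ b≁y b≁y′ with y ≟ y′ | side (partner y) ≟ᵇ side y
    ... | yes y≡y′ | _ = y≡y′
    ... | no y≢y′ | yes sd with PerfectPair-sameSide (pair y) sd (opposite⇒≡ sy′ sy)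
    ...   | inj₁ y′≡y = ⊥-elim (y≢y′ (sym y′≡y))
    ...   | inj₂ refl =
      ⊥-elim (Sum.[ b≁y , b≁y′ ]
               (PerfectPair.cover (pair y) b (sy ∘ cong side ∘ sym) (sy′ ∘ cong side ∘ sym)))
    nonNeighbour-unique {b} {y} {y′} sy sy′ b≁y b≁y′ | no y≢y′ | no sd =
      ⊥-elim (b≁y′ (subst (_~ y′) (sym b≡d)
        (Graph.sym G (PerfectPair-oppositeSide (pair y) sd (opposite⇒≡ sy′ sy) (y≢y′ ∘ sym)))))
      where
      b≡d : b ≡ partner y
      b≡d = decidable-stable (b ≟ partner y) λ b≢d →
        b≁y (PerfectPair-oppositeSide (PerfectPair-sym (pair y)) (sd ∘ sym)
                                      (opposite⇒≡ (sy ∘ sym) sd) b≢d)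

    -- The partners of y₁ and y₂ cannot lie on side γ, so both are q, and then q is universal.
    ¬all-but-one-on-side : ∀ γ q → ¬ (∀ {x} → x ≢ q → side x ≡ γ)
    ¬all-but-one-on-side γ q on-γ with fresh (q ∷ []) (≤-trans (s≤s (s≤s z≤n)) 4≤n)
    ... | y₁ , y₁≢q ∷ [] with fresh (q ∷ y₁ ∷ []) (≤-trans (n≤1+n 3) 4≤n)
    ... | y₂ , y₂≢q ∷ y₂≢y₁ ∷ [] with fresh (q ∷ y₁ ∷ y₂ ∷ []) 4≤n
    ... | y₃ , y₃≢q ∷ y₃≢y₁ ∷ y₃≢y₂ ∷ [] = PerfectPair.¬universalʳ (pair y₁) universal
      where
      same : ∀ {y y′} → y ≢ q → y′ ≢ q → side y ≡ side y′
      same y≢q y′≢q = trans (on-γ y≢q) (sym (on-γ y′≢q))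
      partner≡q : ∀ {y} → side (partner y) ≢ side y → y ≢ q → partner y ≡ q
      partner≡q apart y≢q = decidable-stable (partner _ ≟ q) λ d≢q → apart (same d≢q y≢q)
      apart₁ : side (partner y₁) ≢ side y₁
      apart₁ = PerfectPair-crowded⇒opposite (pair y₁) (same y₂≢q y₁≢q) (same y₃≢q y₁≢q)
                                            y₂≢y₁ y₃≢y₁ y₃≢y₂
      apart₂ : side (partner y₂) ≢ side y₂
      apart₂ = PerfectPair-crowded⇒opposite (pair y₂) (same y₁≢q y₂≢q) (same y₃≢q y₂≢q)
                                            (y₂≢y₁ ∘ sym) y₃≢y₂ y₃≢y₁
      universal : Universal _~_ (partner y₁)
      universal w w≢d with w ≟ q | w ≟ y₁
      ... | yes w≡q | _ = ⊥-elim (w≢d (trans w≡q (sym (partner≡q apart₁ y₁≢q))))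
      ... | no w≢q | no w≢y₁ = PerfectPair-oppositeSide (pair y₁) apart₁ (same w≢q y₁≢q) w≢y₁
      ... | no w≢q | yes refl =
        subst (w ~_) (trans (partner≡q apart₂ y₂≢q) (sym (partner≡q apart₁ y₁≢q)))
          (PerfectPair-oppositeSide (pair y₂) apart₂ (same w≢q y₂≢q) (y₂≢y₁ ∘ sym))

    side-nontrivial : ∀ γ → ¬ (∀ {a a′} → side a ≢ γ → side a′ ≢ γ → a ≡ a′)
    side-nontrivial γ subsingleton with any? (λ x → ¬? (side x ≟ᵇ γ))
    ... | yes (q , sq) =
      ¬all-but-one-on-side γ q λ {x} x≢q →
        decidable-stable (side x ≟ᵇ γ) λ sx → x≢q (subsingleton sx sq)
    ... | no none =
      ¬all-but-one-on-side γ (fromℕ< (≤-trans (s≤s z≤n) 4≤n)) λ {x} _ →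
        decidable-stable (side x ≟ᵇ γ) λ sx → none (x , sx)

    side-size≥2 : ∀ {k} γ (ι : Fin k → Fin n) → (∀ {a} → side a ≢ γ → ∃ λ i → ι i ≡ a) → 2 ≤ k
    side-size≥2 γ ι enumerates = decidable-stable (2 ≤? _) λ ¬2≤k → side-nontrivial γ λ sa sa′ →
      let (i , ιi≡a) = enumerates sa ; (i′ , ιi′≡a′) = enumerates sa′
      in trans (sym ιi≡a) (trans (cong ι (¬2≤⇒≡ ¬2≤k i i′)) ιi′≡a′)

    -- If d shared y's side it would miss the whole opposite side, which has two vertices.
    complete-partner : ∀ {y} → Complete y → side (partner y) ≢ side y × Complete (partner y)
    complete-partner {y} complete = apart , complete-d
      where
      d : Fin n
      d = partner y
      apart : side d ≢ side y
      apart sd = side-nontrivial (side y) λ {a} {a′} sa sa′ → nonNeighbour-unique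
        (λ e → sa (trans e sd)) (λ e → sa′ (trans e sd)) (d≁ sa) (d≁ sa′)
        where
        d≁ : ∀ {a} → side a ≢ side y → ¬ d ~ a
        d≁ {a} sa d~a = PerfectPair.exclusive (pair y) a (sa ∘ cong side)
                          (λ a≡d → sa (trans (cong side a≡d) sd))
                          (complete a sa) (Graph.sym G d~a)
      complete-d : Complete d
      complete-d a sa with a ≟ y
      ... | yes refl = Graph.sym G (complete d apart)
      ... | no a≢y = PerfectPair-oppositeSide (pair y) apart (opposite⇒≡ sa (apart ∘ sym)) a≢y

-- Matchings and K_{r,s} − M

module _ {r s m : ℕ} (M : Matching r s m) where

  Unmatchedˡ : Fin r → Set
  Unmatchedˡ x = ∀ t → left M t ≢ x

  Unmatchedʳ : Fin s → Set
  Unmatchedʳ y = ∀ t → right M t ≢ y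

  inMatching-uniqueˡ : ∀ {x x′ y} → InMatching M x y → InMatching M x′ y → x ≡ x′
  inMatching-uniqueˡ (t , refl , rt≡y) (t′ , refl , rt′≡y) =
    cong (left M) (right-inj M (trans rt≡y (sym rt′≡y)))

  inMatching-uniqueʳ : ∀ {x y y′} → InMatching M x y → InMatching M x y′ → y ≡ y′
  inMatching-uniqueʳ (t , lt≡x , refl) (t′ , lt′≡x , refl) =
    cong (right M) (left-inj M (trans lt≡x (sym lt′≡x)))

module _ {r s : ℕ} {E : Fin r → Fin s → Set} (E? : ∀ x y → Dec (E x y))
         (uniqueˡ : ∀ {x y y′} → ¬ E x y → ¬ E x y′ → y ≡ y′)
         (uniqueʳ : ∀ {x x′ y} → ¬ E x y → ¬ E x′ y → x ≡ x′) where

  nonEdge-matching : ∃ λ m → Σ (Matching r s m) λ M → ∀ x y → InMatching M x y ⇔ (¬ E x y)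
  nonEdge-matching = #P , M , inM⇔
    where
    Matched : Fin r → Set
    Matched x = ∃ λ y → ¬ E x y
    S : Split Matched (¬_ ∘ Matched)
    S = split (λ x → any? (λ y → ¬? (E? x y)))
    open Split S
    ¬E : ∀ t → ¬ E (from (inj₁ t)) (proj₁ (from-inj₁ t))
    ¬E = proj₂ ∘ from-inj₁
    M : Matching r s #P
    M = record
      { left = from ∘ inj₁
      ; right = proj₁ ∘ from-inj₁
      ; left-inj = inj₁-injective ∘ from-injective
      ; right-inj = λ {t} {t′} e →
          inj₁-injective (from-injective (uniqueʳ (¬E t) (subst (¬_ ∘ E _) (sym e) (¬E t′)))) }
    inM⇔ : ∀ x y → InMatching M x y ⇔ (¬ E x y)
    inM⇔ x y = mk⇔ (λ { (t , refl , refl) → ¬E t }) λ ¬Exy →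
      let (t , lt≡x) = inj₁-preimage S (y , ¬Exy)
      in t , lt≡x , uniqueˡ (subst (λ a → ¬ E a (proj₁ (from-inj₁ t))) lt≡x (¬E t)) ¬Exy

module _ {n : ℕ} (G : Graph n) where

  Split⇒IsoKminus : ∀ {P Q : Fin n → Set} (S : Split P Q) {m} (M : Matching (Split.#P S) (Split.#Q S) m) →
                    (∀ w w′ → Adj G (Split.from S w) (Split.from S w′) ⇔ KminusAdj M w w′) → IsoKminus G M
  Split⇒IsoKminus S M adj⇔ = bijection , λ u v →
    subst₂ (λ a b → Adj G a b ⇔ KminusAdj M (to u) (to v)) (from-to u) (from-to v) (adj⇔ (to u) (to v))
    where open Split S

  perfectMatching⇒InT1 : ∀ {r s m} → m ≡ r → m ≡ s → 2 ≤ r →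
                         (M : Matching r s m) → IsoKminus G M → InT1 G
  perfectMatching⇒InT1 refl refl 2≤r M iso = _ , 2≤r , M , iso

module _ {n : ℕ} (G : Graph n) (triangleFree : TriangleFree G) (4≤n : 4 ≤ n)
         (partnered : Partnered (Adj G)) where
  private
    _~_ : Fin n → Fin n → Set
    _~_ = Adj G

    bipartition : Σ (Fin n → Bool) (Bipartition G)
    bipartition = PerfectPair⇒bipartition G triangleFree (proj₂ (partnered (fromℕ< (≤-trans (s≤s z≤n) 4≤n))))

    side : Fin n → Bool
    side = proj₁ bipartition

    open BipartiteGraph G (proj₂ bipartition)
    open WithPartners 4≤n partnered

    S : Split (λ w → side w ≡ true) (λ w → side w ≢ true)
    S = split (λ w → side w ≟ᵇ true)
    open Split S using (#P; #Q; from; from-inj₁; from-inj₂; from-injective)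

    r s : ℕ
    r = #P
    s = #Q

    ιX : Fin r → Fin n
    ιX = from ∘ inj₁

    ιY : Fin s → Fin n
    ιY = from ∘ inj₂

    X≢Y : ∀ {x y} → side (ιX x) ≢ side (ιY y)
    X≢Y {x} {y} e = from-inj₂ y (trans (sym e) (from-inj₁ x))

    Y≢X : ∀ {y x} → side (ιY y) ≢ side (ιX x)
    Y≢X = X≢Y ∘ sym

    E : Fin r → Fin s → Set
    E x y = ιX x ~ ιY y

    E? : ∀ x y → Dec (E x y)
    E? x y = adj? G (ιX x) (ιY y)

    matching : ∃ λ m → Σ (Matching r s m) λ M → ∀ x y → InMatching M x y ⇔ (¬ E x y)
    matching = nonEdge-matching E?
      (λ ¬Exy ¬Exy′ → inj₂-injective (from-injective (nonNeighbour-unique Y≢X Y≢X ¬Exy ¬Exy′)))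
      (λ ¬Exy ¬Ex′y → inj₁-injective (from-injective
                         (nonNeighbour-unique X≢Y X≢Y (¬Exy ∘ Graph.sym G) (¬Ex′y ∘ Graph.sym G))))

    m : ℕ
    m = proj₁ matching

    M : Matching r s m
    M = proj₁ (proj₂ matching)

    inM⇔¬E : ∀ x y → InMatching M x y ⇔ (¬ E x y)
    inM⇔¬E = proj₂ (proj₂ matching)

    E⇔¬inM : ∀ x y → E x y ⇔ (¬ InMatching M x y)
    E⇔¬inM x y = mk⇔ (λ Exy inM → Equivalence.to (inM⇔¬E x y) inM Exy)
                     (λ ¬inM → decidable-stable (E? x y) (¬inM ∘ Equivalence.from (inM⇔¬E x y)))

    adj⇔ : ∀ w w′ → from w ~ from w′ ⇔ KminusAdj M w w′
    adj⇔ (inj₁ x) (inj₁ x′) = mk⇔ (proj₂ bipartition (trans (from-inj₁ x) (sym (from-inj₁ x′)))) ⊥-elim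
    adj⇔ (inj₂ y) (inj₂ y′) = mk⇔ (proj₂ bipartition (opposite⇒≡ (from-inj₂ y) (from-inj₂ y′))) ⊥-elim
    adj⇔ (inj₁ x) (inj₂ y) = E⇔¬inM x y
    adj⇔ (inj₂ y) (inj₁ x) = mk⇔ (Equivalence.to (E⇔¬inM x y) ∘ Graph.sym G)
                                 (Graph.sym G ∘ Equivalence.from (E⇔¬inM x y))

    iso : IsoKminus G M
    iso = Split⇒IsoKminus G S M adj⇔

    2≤r : 2 ≤ r
    2≤r = side-size≥2 false ιX (inj₁-preimage S ∘ ¬-not)

    2≤s : 2 ≤ s
    2≤s = side-size≥2 true ιY (inj₂-preimage S)

    CompleteX : Fin r → Set
    CompleteX x = ∀ y → E x y

    CompleteY : Fin s → Set
    CompleteY y = ∀ x → E x y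

    onY : ∀ {a x} → side a ≢ side (ιX x) → ∃ λ y → ιY y ≡ a
    onY {x = x} sa = inj₂-preimage S (λ e → sa (trans e (sym (from-inj₁ x))))

    onX : ∀ {a y} → side a ≢ side (ιY y) → ∃ λ x → ιX x ≡ a
    onX {y = y} sa = inj₁-preimage S (¬-not λ e → sa (trans e (sym (¬-not (from-inj₂ y)))))

    CompleteX⇒Complete : ∀ {x} → CompleteX x → Complete (ιX x)
    CompleteX⇒Complete complete-x a sa with onY sa
    ... | y , refl = Graph.sym G (complete-x y)

    CompleteY⇒Complete : ∀ {y} → CompleteY y → Complete (ιY y)
    CompleteY⇒Complete complete-y a sa with onX sa
    ... | x , refl = complete-y x

    Complete⇒CompleteX : ∀ {x a} → ιX x ≡ a → Complete a → CompleteX x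
    Complete⇒CompleteX refl complete y = Graph.sym G (complete (ιY y) Y≢X)

    Complete⇒CompleteY : ∀ {y a} → ιY y ≡ a → Complete a → CompleteY y
    Complete⇒CompleteY refl complete x = complete (ιX x) X≢Y

    CompleteX⇒opposite : ∀ {x} → CompleteX x → ∃ CompleteY
    CompleteX⇒opposite complete-x =
      let (apart , complete-d) = complete-partner (CompleteX⇒Complete complete-x)
          (y , y↦d) = onY apart
      in y , Complete⇒CompleteY y↦d complete-d

    CompleteY⇒opposite : ∀ {y} → CompleteY y → ∃ CompleteX
    CompleteY⇒opposite complete-y =
      let (apart , complete-d) = complete-partner (CompleteY⇒Complete complete-y)
          (x , x↦d) = onX apart
      in x , Complete⇒CompleteX x↦d complete-d

    CompleteX⇒unmatched : ∀ {x} → CompleteX x → Unmatchedˡ M x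
    CompleteX⇒unmatched {x} complete-x t lt≡x =
      Equivalence.to (inM⇔¬E x (right M t)) (t , lt≡x , refl) (complete-x (right M t))

    CompleteY⇒unmatched : ∀ {y} → CompleteY y → Unmatchedʳ M y
    CompleteY⇒unmatched {y} complete-y t rt≡y =
      Equivalence.to (inM⇔¬E (left M t) y) (t , refl , rt≡y) (complete-y (left M t))

    ¬CompleteX⇒matched : ∀ {x} → ¬ CompleteX x → ∃ λ t → left M t ≡ x
    ¬CompleteX⇒matched {x} ¬complete =
      let (y , ¬Exy) = ¬∀⟶∃¬ _ _ (E? x) ¬complete
          (t , lt≡x , _) = Equivalence.from (inM⇔¬E x y) ¬Exy
      in t , lt≡x

    ¬CompleteY⇒matched : ∀ {y} → ¬ CompleteY y → ∃ λ t → right M t ≡ y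
    ¬CompleteY⇒matched {y} ¬complete =
      let (x , ¬Exy) = ¬∀⟶∃¬ _ _ (λ x → E? x y) ¬complete
          (t , _ , rt≡y) = Equivalence.from (inM⇔¬E x y) ¬Exy
      in t , rt≡y

  -- The unmatched vertices are the complete ones, and they occur on both sides or on neither.
  Partnered⇒InT1⊎InT2 : InT1 G ⊎ InT2 G
  Partnered⇒InT1⊎InT2 with any? (λ x → all? (E? x))
  ... | yes (x₀ , complete-x₀) =
    let (y₀ , complete-y₀) = CompleteX⇒opposite complete-x₀
    in inj₂ (r , s , m , 2≤r , 2≤s ,
             ⊓-glb (injective-missing⇒< (left-inj M) x₀ (CompleteX⇒unmatched complete-x₀))
                   (injective-missing⇒< (right-inj M) y₀ (CompleteY⇒unmatched complete-y₀)) ,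
             M , iso)
  ... | no ¬complete = inj₁ (perfectMatching⇒InT1 G
          (injective∧surjective⇒≡ (left-inj M) λ x →
             ¬CompleteX⇒matched λ complete-x → ¬complete (x , complete-x))
          (injective∧surjective⇒≡ (right-inj M) λ y → ¬CompleteY⇒matched (¬complete ∘ CompleteY⇒opposite))
          2≤r M iso)

module _ {r s m : ℕ} (M : Matching r s m) where

  Mates : Fin r → Fin s → Set
  Mates x y = InMatching M x y ⊎ (Unmatchedˡ M x × Unmatchedʳ M y)

  module _ (2≤r : 2 ≤ r) (2≤s : 2 ≤ s) where
    private
      _~_ : Fin r ⊎ Fin s → Fin r ⊎ Fin s → Set
      _~_ = KminusAdj M

    ¬universal-inj₁ : ∀ {x} → ¬ Universal _~_ (inj₁ x)
    ¬universal-inj₁ {x} univ = let (x′ , x′≢x) = another 2≤r x in univ (inj₁ x′) (x′≢x ∘ inj₁-injective)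

    ¬universal-inj₂ : ∀ {y} → ¬ Universal _~_ (inj₂ y)
    ¬universal-inj₂ {y} univ = let (y′ , y′≢y) = another 2≤s y in univ (inj₂ y′) (y′≢y ∘ inj₂-injective)

    Mates⇒PerfectPair : ∀ {x y} → Mates x y → PerfectPair _~_ (inj₁ x) (inj₂ y)
    Mates⇒PerfectPair {x} {y} mates = record
      { distinct = λ ()
      ; ¬universalˡ = ¬universal-inj₁
      ; ¬universalʳ = ¬universal-inj₂
      ; cover = cover mates
      ; exclusive = λ { (inj₁ _) _ _ () _ ; (inj₂ _) _ _ _ () } }
      where
      cover : Mates x y → ∀ w → w ≢ inj₁ x → w ≢ inj₂ y → w ~ inj₁ x ⊎ w ~ inj₂ y
      cover (inj₁ edge) (inj₁ x′) w≢x _ = inj₂ λ edge′ → w≢x (cong inj₁ (inMatching-uniqueˡ M edge′ edge))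
      cover (inj₁ edge) (inj₂ y′) _ w≢y = inj₁ λ edge′ → w≢y (cong inj₂ (inMatching-uniqueʳ M edge′ edge))
      cover (inj₂ (_ , unmatched-y)) (inj₁ x′) _ _ = inj₂ λ (t , _ , rt≡y) → unmatched-y t rt≡y
      cover (inj₂ (unmatched-x , _)) (inj₂ y′) _ _ = inj₁ λ (t , lt≡x , _) → unmatched-x t lt≡x

    module _ (balancedˡ : ∃ (Unmatchedˡ M) → ∃ (Unmatchedʳ M))
                (balancedʳ : ∃ (Unmatchedʳ M) → ∃ (Unmatchedˡ M)) where

      mateʳ : ∀ x → ∃ (Mates x)
      mateʳ x with any? (λ t → left M t ≟ x)
      ... | yes (t , lt≡x) = right M t , inj₁ (t , lt≡x , refl)
      ... | no unhit = let (y , unmatched-y) = balancedˡ (x , λ t lt≡x → unhit (t , lt≡x))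
                       in y , inj₂ ((λ t lt≡x → unhit (t , lt≡x)) , unmatched-y)

      mateˡ : ∀ y → ∃ λ x → Mates x y
      mateˡ y with any? (λ t → right M t ≟ y)
      ... | yes (t , rt≡y) = left M t , inj₁ (t , refl , rt≡y)
      ... | no unhit = let (x , unmatched-x) = balancedʳ (y , λ t rt≡y → unhit (t , rt≡y))
                       in x , inj₂ (unmatched-x , λ t rt≡y → unhit (t , rt≡y))

      Kminus-partnered : Partnered _~_
      Kminus-partnered (inj₁ x) = let (y , mates) = mateʳ x in inj₂ y , Mates⇒PerfectPair mates
      Kminus-partnered (inj₂ y) =
        let (x , mates) = mateˡ y in inj₁ x , PerfectPair-sym (Mates⇒PerfectPair mates)

InT1⊎InT2⇒Partnered : ∀ {n} (G : Graph n) → InT1 G ⊎ InT2 G → Partnered (Adj G)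
InT1⊎InT2⇒Partnered G (inj₁ (r , 2≤r , M , σ , preserves)) =
  Partnered-reflect σ preserves
    (Kminus-partnered M 2≤r 2≤r (⊥-elim ∘ perfect (left-inj M)) (⊥-elim ∘ perfect (right-inj M)))
  where
  perfect : ∀ {f : Fin r → Fin r} → Injective _≡_ _≡_ f → ¬ ∃ (λ j → ∀ i → f i ≢ j)
  perfect f-injective (j , missed) = <-irrefl refl (injective-missing⇒< f-injective j missed)
InT1⊎InT2⇒Partnered G (inj₂ (r , s , m , 2≤r , 2≤s , m<r⊓s , M , σ , preserves)) =
  Partnered-reflect σ preserves (Kminus-partnered M 2≤r 2≤s
    (λ _ → <⇒missing (right M) (≤-trans m<r⊓s (m⊓n≤n r s)))
    (λ _ → <⇒missing (left M) (≤-trans m<r⊓s (m⊓n≤m r s))))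

theorem4p6 : (n : ℕ) → 4 ≤ n → (G : Graph n) → TriangleFree G →
    PRCis G n ⇔ (InT1 G ⊎ InT2 G)
theorem4p6 n 4≤n G triangleFree = mk⇔
  (Partnered⇒InT1⊎InT2 G triangleFree 4≤n ∘ PRC-n⇒Partnered G triangleFree 4≤n)
  (Partnered⇒PRC-n G ∘ InT1⊎InT2⇒Partnered G)
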